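{- Let $P=\{(n_0,\dots,n_6) \mid n_0=0,\ n_1=n_2=n_3+n_4=n_5=n_6\}$. A position $M=(n_0,\dots,n_6)$ of ${\rm ECN}(7_{\{1,2\}},5)$ is a $\mathcal{P}$-position if and only if $M\in_\circlearrowleft P$.
   Context: Extended circular nim ${\rm ECN}(m_S,k)$ (positive integers $k\le m$, $S$ a set of positive integers each at most $m/2$): there are $m$ piles $v_0,\dots,v_{m-1}$ arranged in a circle (indices mod $m$); a position is a tuple $(n_0,\dots,n_{m-1})$ of nonnegative integers, $n_i$ being the number of tokens on $v_i$. A move chooses $s\in S$, $i\in\{0,\dots,m-1\}$, $j\in\{0,\dots,k-1\}$ and removes an arbitrary nonnegative number of tokens from each pile $v_{(i+ts)\bmod m}$, $t=0,\dots,j$, removing at least one token in total (empty piles still count as piles). Normal play: the player unable to move loses. A $\mathcal{P}$-position is a position from which the previous player (the player who just moved) has a winning strategy. For a set $P$ of $m$-tuples and $M=(n_0,\dots,n_{m-1})$, $M\in_\circlearrowleft P$ means there exists $i<m$ such that $(n_i,n_{(i+1)\bmod m},\dots,n_{(i+m-1)\bmod m})\in P$ or $(n_i,n_{(i+m-1)\bmod m},\dots,n_{(i+1)\bmod m})\in P$. -}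

module Defs where

open import Data.Nat using (ℕ; zero; suc; _+_; _*_; _∸_; _≤_; _<_; NonZero)
open import Data.Nat.DivMod using (_%_; m%n<n)
open import Data.Fin using (Fin; toℕ; fromℕ<)
open import Data.List using (List; _∷_; [])
open import Data.List.Membership.Propositional using (_∈_)
open import Data.Product using (Σ; ∃; _×_; _,_)
open import Data.Sum using (_⊎_)
open import Relation.Binary.PropositionalEquality using (_≡_; _≢_)

Position : ℕ → Set
Position m = Fin m → ℕ

idx : (m : ℕ) → .{{_ : NonZero m}} → ℕ → Fin m
idx m x = fromℕ< (m%n<n x m)

-- One move of ECN(m_S, k) from M to M':
-- choose s ∈ S, i < m, j < k, and remove tokens only from the piles
-- v_{(i + t s) mod m}, t = 0..j, removing at least one token in total.
record Move (m : ℕ) .{{_ : NonZero m}} (S : List ℕ) (k : ℕ)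
            (M M' : Position m) : Set where
  field
    s        : ℕ
    s∈S      : s ∈ S
    i        : Fin m
    j        : ℕ
    j<k      : j < k
    removes  : ∀ p → M' p ≤ M p
    onlyAffected : ∀ p → M' p ≢ M p →
                   ∃ λ t → t ≤ j × toℕ p ≡ (toℕ i + t * s) % m
    nontrivial : ∃ λ p → M' p < M p

-- P-positions / N-positions under normal play, defined inductively
-- (the game is finite since every move decreases the total number of tokens).
mutual
  data IsP (m : ℕ) .{{_ : NonZero m}} (S : List ℕ) (k : ℕ) (M : Position m) : Set where
    isP : (∀ M' → Move m S k M M' → IsN m S k M') → IsP m S k M

  data IsN (m : ℕ) .{{_ : NonZero m}} (S : List ℕ) (k : ℕ) (M : Position m) : Set where
    isN : (M' : Position m) → Move m S k M M' → IsP m S k M' → IsN m S k M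

-- M ∈↻ P : some rotation (n_i, n_{i+1}, ..., n_{i+m-1}) or reflected rotation
-- (n_i, n_{i+m-1}, ..., n_{i+1}) lies in P (indices mod m).
_∈↻_ : {m : ℕ} .{{_ : NonZero m}} → Position m → (Position m → Set) → Set
_∈↻_ {m} M P =
  ∃ λ (i : Fin m) →
    P (λ q → M (idx m (toℕ i + toℕ q)))
    ⊎ P (λ q → M (idx m (toℕ i + (m ∸ 1) * toℕ q)))

P₇ : Position 7 → Set
P₇ n = n (# 0) ≡ 0
     × n (# 1) ≡ n (# 2)
     × n (# 2) ≡ n (# 3) + n (# 4)
     × n (# 3) + n (# 4) ≡ n (# 5)
     × n (# 5) ≡ n (# 6)
  where open import Data.Fin using (#_)

-- A move lowers piles only along v_i, v_{i+s}, …, v_{i+4s} with s ∈ {1, 2}, so the moves are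
-- exactly the decreases that leave two piles at distance s untouched. Up to rotation (P is closed
-- under reflection) a position of P is (0, b, b, x, y, b, b) with x + y = b, holding 5b tokens.
-- A move between two of them lowers b, so its untouched pair avoids the four piles of the first
-- equal to b and is its middle pair {x, y}; but two adjacent piles of the second sum to at most its
-- b plus the opposite pile, here the empty one. Conversely, after rotating a smallest pile to v_0
-- and reflecting so that v_3 ≤ v_4, four cases on the order of min(v_1, v_2, v_5), v_4 and v_6 give
-- a position of P below the given one that agrees with it on such a pair. Moves decrease the total,
-- so these two facts determine the P-positions.

module Submission where

open import Defs
open import Data.Nat using (ℕ; zero; suc; _+_; _*_; _∸_; _≤_; _<_; _%_; _⊓_; z≤n; s≤s; NonZero)
open import Data.Nat.Properties
open import Data.Nat.DivMod using (m%n<n; %-distribˡ-+; m%n%n≡m%n; m<n⇒m%n≡m; n%n≡0)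
open import Data.Nat.Induction using (<-wellFounded)
open import Data.Nat.Tactic.RingSolver using (solve-∀)
open import Data.Fin using (Fin; toℕ) renaming (suc to fsuc)
open import Data.Fin.Patterns using (0F; 1F; 2F; 3F; 4F; 5F; 6F)
open import Data.Fin.Properties
  using (toℕ-fromℕ<; fromℕ<-cong; fromℕ<-toℕ; toℕ<n; toℕ≤n; toℕ≤pred[n]; toℕ-injective; any?)
open import Data.Fin.Permutation using (permutation)
open import Data.Vec.Functional.Relation.Binary.Pointwise using (Pointwise)
open import Data.List using (List; _∷_; [])
open import Data.List.Membership.Propositional using (_∈_)
open import Data.List.Relation.Unary.Any using (here; there)
open import Data.Product using (∃; ∃₂; _×_; _,_; proj₁; proj₂)
open import Data.Sum using (_⊎_; inj₁; inj₂; [_,_]′)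
open import Data.Empty using (⊥; ⊥-elim)
open import Function using (_∘_)
open import Function.Bundles using (_⇔_; mk⇔)
open import Function.Construct.Composition using (_⇔-∘_)
open import Induction.WellFounded using (WellFounded; Acc; acc)
import Relation.Binary.Construct.On as On
open import Relation.Nullary using (¬_; Dec; yes; no; contradiction)
open import Relation.Binary.PropositionalEquality
open import Relation.Binary.PropositionalEquality.Algebra using (isMagma)
open import Algebra.Bundles using (AbelianGroup)
open import Algebra.Structures using (IsAbelianGroup)
open import Algebra.Properties.CommutativeMonoid.Sum +-0-commutativeMonoid
  using (sum; sum-permute; sum-cong-≗)
import Algebra.Properties.AbelianGroup as AbelianGroupProperties

private variable n : ℕ

%-absorbˡ : ∀ x y → (x % suc n + y) % suc n ≡ (x + y) % suc n
%-absorbˡ {n} x y = begin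
  (x % suc n + y) % suc n                  ≡⟨ %-distribˡ-+ (x % suc n) y (suc n) ⟩
  (x % suc n % suc n + y % suc n) % suc n  ≡⟨ cong (λ z → (z + y % suc n) % suc n) (m%n%n≡m%n x (suc n)) ⟩
  (x % suc n + y % suc n) % suc n          ≡⟨ %-distribˡ-+ x y (suc n) ⟨
  (x + y) % suc n                          ∎
  where open ≡-Reasoning

toℕ-idx : ∀ x → toℕ (idx (suc n) x) ≡ x % suc n
toℕ-idx {n} x = toℕ-fromℕ< (m%n<n x (suc n))

idx-cong : ∀ x y → x % suc n ≡ y % suc n → idx (suc n) x ≡ idx (suc n) y
idx-cong {n} x y eq = fromℕ<-cong _ _ eq (m%n<n x (suc n)) (m%n<n y (suc n))

idx-toℕ : (a : Fin (suc n)) → idx (suc n) (toℕ a) ≡ a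
idx-toℕ a = trans (fromℕ<-cong _ _ (m<n⇒m%n≡m (toℕ<n a)) _ (toℕ<n a)) (fromℕ<-toℕ a (toℕ<n a))

idx-absorbˡ : ∀ x y → idx (suc n) (toℕ (idx (suc n) x) + y) ≡ idx (suc n) (x + y)
idx-absorbˡ x y = idx-cong (toℕ (idx _ x) + y) (x + y)
  (trans (cong (λ z → (z + y) % _) (toℕ-idx x)) (%-absorbˡ x y))

idx-absorbʳ : ∀ x y → idx (suc n) (x + toℕ (idx (suc n) y)) ≡ idx (suc n) (x + y)
idx-absorbʳ x y = begin
  idx _ (x + toℕ (idx _ y))   ≡⟨ cong (idx _) (+-comm x _) ⟩
  idx _ (toℕ (idx _ y) + x)   ≡⟨ idx-absorbˡ y x ⟩
  idx _ (y + x)               ≡⟨ cong (idx _) (+-comm y x) ⟩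
  idx _ (x + y)               ∎
  where open ≡-Reasoning

infixl 6 _⊕_
_⊕_ : Fin (suc n) → Fin (suc n) → Fin (suc n)
a ⊕ b = idx _ (toℕ a + toℕ b)

infix 8 ⊖_
⊖_ : Fin (suc n) → Fin (suc n)
⊖_ {n} a = idx (suc n) (suc n ∸ toℕ a)

toℕ-⊕-idx : (i : Fin (suc n)) → ∀ x → toℕ (i ⊕ idx (suc n) x) ≡ (toℕ i + x) % suc n
toℕ-⊕-idx i x = trans (cong toℕ (idx-absorbʳ (toℕ i) x)) (toℕ-idx (toℕ i + x))

⊕-assoc : (a b c : Fin (suc n)) → (a ⊕ b) ⊕ c ≡ a ⊕ (b ⊕ c)
⊕-assoc a b c = begin
  idx _ (toℕ (a ⊕ b) + toℕ c)       ≡⟨ idx-absorbˡ (toℕ a + toℕ b) (toℕ c) ⟩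
  idx _ (toℕ a + toℕ b + toℕ c)     ≡⟨ cong (idx _) (+-assoc (toℕ a) (toℕ b) (toℕ c)) ⟩
  idx _ (toℕ a + (toℕ b + toℕ c))   ≡⟨ idx-absorbʳ (toℕ a) (toℕ b + toℕ c) ⟨
  idx _ (toℕ a + toℕ (b ⊕ c))       ∎
  where open ≡-Reasoning

⊕-comm : (a b : Fin (suc n)) → a ⊕ b ≡ b ⊕ a
⊕-comm a b = cong (idx _) (+-comm (toℕ a) (toℕ b))

⊕-identityˡ : (a : Fin (suc n)) → 0F ⊕ a ≡ a
⊕-identityˡ = idx-toℕ

⊕-identityʳ : (a : Fin (suc n)) → a ⊕ 0F ≡ a
⊕-identityʳ a = trans (⊕-comm a 0F) (⊕-identityˡ a)

⊖-inverseˡ : (a : Fin (suc n)) → ⊖ a ⊕ a ≡ 0F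
⊖-inverseˡ {n} a = begin
  idx _ (toℕ (⊖ a) + toℕ a)       ≡⟨ idx-absorbˡ (suc n ∸ toℕ a) (toℕ a) ⟩
  idx _ (suc n ∸ toℕ a + toℕ a)   ≡⟨ cong (idx _) (m∸n+n≡m (toℕ≤n a)) ⟩
  idx _ (suc n)                   ≡⟨ idx-cong (suc n) 0 (n%n≡0 (suc n)) ⟩
  0F                              ∎
  where open ≡-Reasoning

⊕-isAbelianGroup : IsAbelianGroup _≡_ (_⊕_ {n}) 0F ⊖_
⊕-isAbelianGroup = record
  { isGroup = record
    { isMonoid = record
      { isSemigroup = record { isMagma = isMagma _⊕_ ; assoc = ⊕-assoc }
      ; identity    = ⊕-identityˡ , ⊕-identityʳ
      }
    ; inverse = ⊖-inverseˡ , λ a → trans (⊕-comm a (⊖ a)) (⊖-inverseˡ a)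
    ; ⁻¹-cong = cong ⊖_
    }
  ; comm = ⊕-comm
  }

⊕-abelianGroup : ℕ → AbelianGroup _ _
⊕-abelianGroup n = record { isAbelianGroup = ⊕-isAbelianGroup {n} }

rotate : Fin (suc n) → Position (suc n) → Position (suc n)
rotate r X q = X (r ⊕ q)

mirror : Position (suc n) → Position (suc n)
mirror X q = X (⊖ q)

argmin : (f : Fin (suc n) → ℕ) → ∃ λ p → ∀ q → f p ≤ f q
argmin {zero}  f = 0F , λ { 0F → ≤-refl }
argmin {suc n} f with argmin (f ∘ fsuc)
... | p , min with ≤-total (f 0F) (f (fsuc p))
...   | inj₁ 0≤p = 0F , λ { 0F → ≤-refl ; (fsuc q) → ≤-trans 0≤p (min q) }
...   | inj₂ p≤0 = fsuc p , λ { 0F → p≤0 ; (fsuc q) → min q }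

sum-mono-≤ : {f g : Position n} → Pointwise _≤_ f g → sum f ≤ sum g
sum-mono-≤ {zero}  _   = z≤n
sum-mono-≤ {suc n} f≤g = +-mono-≤ (f≤g 0F) (sum-mono-≤ (f≤g ∘ fsuc))

sum-mono-< : {f g : Position n} → Pointwise _≤_ f g → ∃ (λ i → f i < g i) → sum f < sum g
sum-mono-< {suc n} f≤g (0F , f<g)     = +-mono-<-≤ f<g (sum-mono-≤ (f≤g ∘ fsuc))
sum-mono-< {suc n} f≤g (fsuc i , f<g) = +-mono-≤-< (f≤g 0F) (sum-mono-< (f≤g ∘ fsuc) (i , f<g))

module _ {n : ℕ} where
  open AbelianGroupProperties (⊕-abelianGroup n) using (\\-leftDividesˡ; \\-leftDividesʳ)

  sum-rotate : ∀ r (X : Position (suc n)) → sum (rotate r X) ≡ sum X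
  sum-rotate r X = sym (sum-permute X (permutation (r ⊕_) (⊖ r ⊕_) (\\-leftDividesˡ r) (\\-leftDividesʳ r)))

module _ {m : ℕ} .{{_ : NonZero m}} {S : List ℕ} {k : ℕ} where

  Move⇒sum-< : ∀ {M M'} → Move m S k M M' → sum M' < sum M
  Move⇒sum-< mv = sum-mono-< (Move.removes mv) (Move.nontrivial mv)

  IsP⇒¬IsN : ∀ {M} → IsP m S k M → ¬ IsN m S k M
  IsP⇒¬IsN (isP next) (isN M' mv p') = IsP⇒¬IsN p' (next M' mv)

  IsP⇔ : (Q : Position m → Set) →
         (∀ {M M'} → Q M → Move m S k M M' → ¬ Q M') →
         (∀ M → Q M ⊎ ∃ λ M' → Move m S k M M' × Q M') →
         ∀ M → IsP m S k M ⇔ Q M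
  IsP⇔ Q stable reach M = mk⇔ IsP⇒Q (proj₁ (classify M (wf M)))
    where
    wf : WellFounded (λ M' M → sum M' < sum M)
    wf = On.wellFounded sum <-wellFounded

    classify : ∀ M → Acc (λ M' M → sum M' < sum M) M → (Q M → IsP m S k M) × (¬ Q M → IsN m S k M)
    classify M (acc rs) = Q⇒IsP , ¬Q⇒IsN
      where
      after : ∀ {M'} → Move m S k M M' → (Q M' → IsP m S k M') × (¬ Q M' → IsN m S k M')
      after mv = classify _ (rs (Move⇒sum-< mv))

      Q⇒IsP : Q M → IsP m S k M
      Q⇒IsP q = isP λ M' mv → proj₂ (after mv) (stable q mv)

      ¬Q⇒IsN : ¬ Q M → IsN m S k M
      ¬Q⇒IsN ¬q with reach M
      ... | inj₁ q              = contradiction q ¬q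
      ... | inj₂ (M' , mv , q') = isN M' mv (proj₁ (after mv) q')

    IsP⇒Q : IsP m S k M → Q M
    IsP⇒Q (isP next) with reach M
    ... | inj₁ q              = q
    ... | inj₂ (M' , mv , q') = ⊥-elim (IsP⇒¬IsN (proj₁ (classify M' (wf M')) q') (next M' mv))

open AbelianGroupProperties (⊕-abelianGroup 6)
  using (\\-leftDividesˡ; \\-leftDividesʳ; //-rightDividesˡ; ∙-cancelˡ; ⁻¹-involutive; ⁻¹-∙-comm)

strides : List ℕ
strides = 1 ∷ 2 ∷ []

-- T agrees with X on two piles s apart: v_{i+5s} and v_{i+6s} are the piles a move along
-- v_i, v_{i+s}, …, v_{i+4s} leaves alone.
Keeps : Position 7 → Position 7 → Set
Keeps X T = ∃₂ λ c s → s ∈ strides × T c ≡ X c × T (c ⊕ idx 7 s) ≡ X (c ⊕ idx 7 s)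

keeps-at : {X T : Position 7} {p q : Fin 7} → p ≡ q → T q ≡ X q → T p ≡ X p
keeps-at refl eq = eq

strides-miss : ∀ {s} t → s ∈ strides → t < 5 →
               idx 7 (t * s) ≢ idx 7 (5 * s) × idx 7 (t * s) ≢ idx 7 (5 * s) ⊕ idx 7 s
strides-miss 0 (here refl)         _ = (λ ()) , (λ ())
strides-miss 1 (here refl)         _ = (λ ()) , (λ ())
strides-miss 2 (here refl)         _ = (λ ()) , (λ ())
strides-miss 3 (here refl)         _ = (λ ()) , (λ ())
strides-miss 4 (here refl)         _ = (λ ()) , (λ ())
strides-miss 0 (there (here refl)) _ = (λ ()) , (λ ())
strides-miss 1 (there (here refl)) _ = (λ ()) , (λ ())
strides-miss 2 (there (here refl)) _ = (λ ()) , (λ ())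
strides-miss 3 (there (here refl)) _ = (λ ()) , (λ ())
strides-miss 4 (there (here refl)) _ = (λ ()) , (λ ())
strides-miss (suc (suc (suc (suc (suc t))))) _ (s≤s (s≤s (s≤s (s≤s (s≤s ())))))

strides-cover : ∀ {s} e → s ∈ strides → e ≢ 0F → e ≢ idx 7 s →
                ∃ λ (t : Fin 5) → e ≡ idx 7 (2 * s) ⊕ idx 7 (toℕ t * s)
strides-cover 0F _                   e≢0 _   = contradiction refl e≢0
strides-cover 1F (here refl)         _   e≢s = contradiction refl e≢s
strides-cover 2F (here refl)         _   _   = 0F , refl
strides-cover 3F (here refl)         _   _   = 1F , refl
strides-cover 4F (here refl)         _   _   = 2F , refl
strides-cover 5F (here refl)         _   _   = 3F , refl
strides-cover 6F (here refl)         _   _   = 4F , refl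
strides-cover 1F (there (here refl)) _   _   = 2F , refl
strides-cover 2F (there (here refl)) _   e≢s = contradiction refl e≢s
strides-cover 3F (there (here refl)) _   _   = 3F , refl
strides-cover 4F (there (here refl)) _   _   = 0F , refl
strides-cover 5F (there (here refl)) _   _   = 4F , refl
strides-cover 6F (there (here refl)) _   _   = 1F , refl

Move⇒Keeps : {X T : Position 7} → Move 7 strides 5 X T → Keeps X T
Move⇒Keeps {X} {T} mv =
  i ⊕ idx 7 (5 * s) , s , s∈S ,
  untouched (λ t → proj₁ ∘ strides-miss t s∈S) ,
  keeps-at {X} {T} (⊕-assoc i _ _) (untouched (λ t → proj₂ ∘ strides-miss t s∈S))
  where
  open Move mv

  untouched : ∀ {o} → (∀ t → t < 5 → idx 7 (t * s) ≢ o) → T (i ⊕ o) ≡ X (i ⊕ o)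
  untouched {o} misses with T (i ⊕ o) ≟ X (i ⊕ o)
  ... | yes same = same
  ... | no moved with onlyAffected (i ⊕ o) moved
  ...   | t , t≤j , hit = contradiction (sym (∙-cancelˡ i _ _ i⊕o≡)) (misses t (≤-<-trans t≤j j<k))
    where
    i⊕o≡ : i ⊕ o ≡ i ⊕ idx 7 (t * s)
    i⊕o≡ = toℕ-injective (trans hit (sym (toℕ-⊕-idx i (t * s))))

Keeps⇒Move : {X T : Position 7} → Pointwise _≤_ T X → ∃ (λ p → T p < X p) → Keeps X T →
             Move 7 strides 5 X T
Keeps⇒Move {X} {T} T≤X T<X (c , s , s∈S , keep₁ , keep₂) = record
  -- c + 2s, …, c + 6s are all piles but c and c + s = c + 8s.
  { s = s ; s∈S = s∈S ; i = c ⊕ idx 7 (2 * s) ; j = 4 ; j<k = ≤-refl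
  ; removes = T≤X ; onlyAffected = affected ; nontrivial = T<X }
  where
  from-c : ∀ {p e} → ⊖ c ⊕ p ≡ e → p ≡ c ⊕ e
  from-c {p} eq = trans (sym (\\-leftDividesˡ c p)) (cong (c ⊕_) eq)

  affected : ∀ p → T p ≢ X p → ∃ λ t → t ≤ 4 × toℕ p ≡ (toℕ (c ⊕ idx 7 (2 * s)) + t * s) % 7
  affected p moved with strides-cover (⊖ c ⊕ p) s∈S
                          (λ eq → moved (keeps-at {X} {T} (trans (from-c eq) (⊕-identityʳ c)) keep₁))
                          (λ eq → moved (keeps-at {X} {T} (from-c eq) keep₂))
  ... | t , eq = toℕ t , toℕ≤pred[n] t , (begin
    toℕ p                                                  ≡⟨ cong toℕ (from-c eq) ⟩
    toℕ (c ⊕ (idx 7 (2 * s) ⊕ idx 7 (toℕ t * s)))         ≡⟨ cong toℕ (⊕-assoc c _ _) ⟨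
    toℕ (c ⊕ idx 7 (2 * s) ⊕ idx 7 (toℕ t * s))           ≡⟨ toℕ-⊕-idx (c ⊕ idx 7 (2 * s)) (toℕ t * s) ⟩
    (toℕ (c ⊕ idx 7 (2 * s)) + toℕ t * s) % 7               ∎)
    where open ≡-Reasoning

RotP₇ : Position 7 → Set
RotP₇ X = ∃ λ r → P₇ (rotate r X)

P₇-cong : {X Y : Position 7} → X ≗ Y → P₇ X → P₇ Y
P₇-cong X≗Y (e₀ , e₁ , e₂ , e₃ , e₄) =
  trans (sym (X≗Y 0F)) e₀ ,
  trans (sym (X≗Y 1F)) (trans e₁ (X≗Y 2F)) ,
  trans (sym (X≗Y 2F)) (trans e₂ (cong₂ _+_ (X≗Y 3F) (X≗Y 4F))) ,
  trans (sym (cong₂ _+_ (X≗Y 3F) (X≗Y 4F))) (trans e₃ (X≗Y 5F)) ,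
  trans (sym (X≗Y 5F)) (trans e₄ (X≗Y 6F))

shape : ℕ → ℕ → ℕ → Position 7
shape b x y 0F = 0
shape b x y 1F = b
shape b x y 2F = b
shape b x y 3F = x
shape b x y 4F = y
shape b x y 5F = b
shape b x y 6F = b

shape-P₇ : ∀ b x y → x + y ≡ b → P₇ (shape b x y)
shape-P₇ _ _ _ x+y≡b = refl , refl , sym x+y≡b , x+y≡b , refl

P₇⇒≗shape : {Y : Position 7} → P₇ Y → Y ≗ shape (Y 3F + Y 4F) (Y 3F) (Y 4F)
P₇⇒≗shape (e₀ , e₁ , e₂ , e₃ , e₄) = λ where
  0F → e₀
  1F → trans e₁ e₂
  2F → e₂
  3F → refl
  4F → refl
  5F → sym e₃
  6F → sym (trans e₃ e₄)

record Shaped (X : Position 7) : Set where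
  field
    rot    : Fin 7
    x y    : ℕ
    ≗shape : X ≗ rotate rot (shape (x + y) x y)

  top : ℕ
  top = x + y

RotP₇⇒Shaped : {X : Position 7} → RotP₇ X → Shaped X
RotP₇⇒Shaped {X} (r , p) = record
  { rot    = ⊖ r
  ; x      = X (r ⊕ 3F)
  ; y      = X (r ⊕ 4F)
  ; ≗shape = λ q → trans (cong X (sym (\\-leftDividesˡ r q))) (P₇⇒≗shape {rotate r X} p (⊖ r ⊕ q))
  }

sum-shape : ∀ x y → sum (shape (x + y) x y) ≡ 5 * (x + y)
sum-shape x y = total x y
  where
  -- sum (shape (x + y) x y) unfolded, for the ring solver
  total : ∀ x y → x + y + (x + y + (x + (y + (x + y + (x + y + 0))))) ≡ 5 * (x + y)
  total = solve-∀

shape-≤ : ∀ x y q → shape (x + y) x y q ≤ x + y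
shape-≤ x y 0F = z≤n
shape-≤ x y 1F = ≤-refl
shape-≤ x y 2F = ≤-refl
shape-≤ x y 3F = m≤m+n x y
shape-≤ x y 4F = m≤n+m y x
shape-≤ x y 5F = ≤-refl
shape-≤ x y 6F = ≤-refl

shape-edge : ∀ x y e → let S = shape (x + y) x y in S e + S (e ⊕ 1F) ≤ x + y + S (e ⊕ 4F)
shape-edge x y 0F = m≤m+n (x + y) y
shape-edge x y 1F = ≤-refl
shape-edge x y 2F = +-monoʳ-≤ (x + y) (m≤m+n x y)
shape-edge x y 3F = m≤m+n (x + y) 0
shape-edge x y 4F = +-monoˡ-≤ (x + y) (m≤n+m y x)
shape-edge x y 5F = ≤-refl
shape-edge x y 6F = +-monoʳ-≤ (x + y) z≤n

shape-low-pair : ∀ {x y s} e → s ∈ strides →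
                 shape (x + y) x y e < x + y → shape (x + y) x y (e ⊕ idx 7 s) < x + y →
                 e ≡ 3F × s ≡ 1
shape-low-pair 3F (here refl)         _   _   = refl , refl
shape-low-pair 0F (here refl)         _   top = contradiction top (n≮n _)
shape-low-pair 1F (here refl)         top _   = contradiction top (n≮n _)
shape-low-pair 2F (here refl)         top _   = contradiction top (n≮n _)
shape-low-pair 4F (here refl)         _   top = contradiction top (n≮n _)
shape-low-pair 5F (here refl)         top _   = contradiction top (n≮n _)
shape-low-pair 6F (here refl)         top _   = contradiction top (n≮n _)
shape-low-pair 0F (there (here refl)) _   top = contradiction top (n≮n _)
shape-low-pair 1F (there (here refl)) top _   = contradiction top (n≮n _)
shape-low-pair 2F (there (here refl)) top _   = contradiction top (n≮n _)
shape-low-pair 3F (there (here refl)) _   top = contradiction top (n≮n _)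
shape-low-pair 4F (there (here refl)) _   top = contradiction top (n≮n _)
shape-low-pair 5F (there (here refl)) top _   = contradiction top (n≮n _)
shape-low-pair 6F (there (here refl)) top _   = contradiction top (n≮n _)

module _ {X : Position 7} (σ : Shaped X) where
  open Shaped σ

  sum-shaped : sum X ≡ 5 * top
  sum-shaped = trans (sum-cong-≗ ≗shape) (trans (sum-rotate rot (shape top x y)) (sum-shape x y))

  shaped-≤ : ∀ q → X q ≤ top
  shaped-≤ q = subst (_≤ top) (sym (≗shape q)) (shape-≤ x y (rot ⊕ q))

  shaped-⊕ : ∀ e d → X (e ⊕ d) ≡ shape top x y (rot ⊕ e ⊕ d)
  shaped-⊕ e d = trans (≗shape (e ⊕ d)) (cong (shape top x y) (sym (⊕-assoc rot e d)))

  shaped-edge : ∀ e → X e + X (e ⊕ 1F) ≤ top + X (e ⊕ 4F)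
  shaped-edge e = subst₂ (λ u v → u ≤ top + v)
    (sym (cong₂ _+_ (≗shape e) (shaped-⊕ e 1F))) (sym (shaped-⊕ e 4F)) (shape-edge x y (rot ⊕ e))

shapes-no-move : {X T : Position 7} → Shaped X → Shaped T → ¬ Move 7 strides 5 X T
shapes-no-move {X} {T} σ τ mv = kept-pair (Move⇒Keeps mv)
  where
  open Shaped σ
  S : Position 7
  S = shape top x y
  a b : ℕ
  a = top
  b = Shaped.top τ

  b<a : b < a
  b<a = *-cancelˡ-< 5 b a (subst₂ _<_ (sum-shaped τ) (sum-shaped σ) (Move⇒sum-< mv))

  low : ∀ {p} → T p ≡ X p → X p < a
  low {p} kept = ≤-<-trans (subst (_≤ b) kept (shaped-≤ τ p)) b<a

  middle-kept : ∀ {c} → rot ⊕ c ≡ 3F → T c ≡ X c → T (c ⊕ 1F) ≡ X (c ⊕ 1F) → ⊥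
  middle-kept {c} mid keep₁ keep₂ = <⇒≱ b<a (begin
    a                               ≡⟨ cong (λ e → S e + S (e ⊕ 1F)) mid ⟨
    S (rot ⊕ c) + S (rot ⊕ c ⊕ 1F)  ≡⟨ cong₂ _+_ (≗shape c) (shaped-⊕ σ c 1F) ⟨
    X c + X (c ⊕ 1F)                ≡⟨ cong₂ _+_ keep₁ keep₂ ⟨
    T c + T (c ⊕ 1F)                ≤⟨ shaped-edge τ c ⟩
    b + T (c ⊕ 4F)                  ≤⟨ +-monoʳ-≤ b (Move.removes mv (c ⊕ 4F)) ⟩
    b + X (c ⊕ 4F)                  ≡⟨ cong (b +_) (shaped-⊕ σ c 4F) ⟩
    b + S (rot ⊕ c ⊕ 4F)            ≡⟨ cong (λ e → b + S (e ⊕ 4F)) mid ⟩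
    b + 0                           ≡⟨ +-identityʳ b ⟩
    b                               ∎)
    where open ≤-Reasoning

  kept-pair : ¬ Keeps X T
  kept-pair (c , s , s∈S , keep₁ , keep₂) =
    let mid , s≡1 = shape-low-pair (rot ⊕ c) s∈S (subst (_< a) (≗shape c) (low keep₁))
                                                 (subst (_< a) (shaped-⊕ σ c (idx 7 s)) (low keep₂))
    in middle-kept mid keep₁ (subst (λ s → T (c ⊕ idx 7 s) ≡ X (c ⊕ idx 7 s)) s≡1 keep₂)

RotP₇-stable : {X T : Position 7} → RotP₇ X → Move 7 strides 5 X T → ¬ RotP₇ T
RotP₇-stable pX mv pT = shapes-no-move (RotP₇⇒Shaped pX) (RotP₇⇒Shaped pT) mv

RotP₇-cong : {X Y : Position 7} → X ≗ Y → RotP₇ X → RotP₇ Y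
RotP₇-cong {X} {Y} X≗Y (r , p) = r , P₇-cong {rotate r X} {rotate r Y} (X≗Y ∘ (r ⊕_)) p

RotP₇-rotate : {X : Position 7} (s : Fin 7) → RotP₇ X → RotP₇ (rotate s X)
RotP₇-rotate {X} s (r , p) =
  ⊖ s ⊕ r , P₇-cong {rotate r X} {rotate (⊖ s ⊕ r) (rotate s X)} (λ q → cong X (rotated q)) p
  where
  rotated : ∀ q → r ⊕ q ≡ s ⊕ (⊖ s ⊕ r ⊕ q)
  rotated q = trans (cong (_⊕ q) (sym (\\-leftDividesˡ s r))) (⊕-assoc s (⊖ s ⊕ r) q)

P₇-mirror : {Y : Position 7} → P₇ Y → P₇ (mirror Y)
P₇-mirror {Y} (e₀ , e₁ , e₂ , e₃ , e₄) =
  e₀ , sym e₄ , trans (sym e₃) (+-comm (Y 3F) (Y 4F)) , trans (+-comm (Y 4F) (Y 3F)) (sym e₂) , sym e₁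

RotP₇-mirror : {X : Position 7} → RotP₇ X → RotP₇ (mirror X)
RotP₇-mirror {X} (r , p) =
  ⊖ r , P₇-cong {mirror (rotate r X)} {rotate (⊖ r) (mirror X)} (λ q → cong X (mirrored q)) (P₇-mirror {rotate r X} p)
  where
  mirrored : ∀ q → r ⊕ ⊖ q ≡ ⊖ (⊖ r ⊕ q)
  mirrored q = trans (cong (_⊕ ⊖ q) (sym (⁻¹-involutive r))) (⁻¹-∙-comm (⊖ r) q)

Reaches : Position 7 → Set
Reaches X = ∃ λ T → Pointwise _≤_ T X × Keeps X T × RotP₇ T

Reaches-rotate : {X : Position 7} (r : Fin 7) → Reaches (rotate r X) → Reaches X
Reaches-rotate {X} r (T , T≤ , (c , s , s∈S , keep₁ , keep₂) , pT) =
  rotate (⊖ r) T , below , keeps , RotP₇-rotate {T} (⊖ r) pT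
  where
  below : Pointwise _≤_ (rotate (⊖ r) T) X
  below p = subst (T (⊖ r ⊕ p) ≤_) (cong X (\\-leftDividesˡ r p)) (T≤ (⊖ r ⊕ p))

  unrotated : ∀ {p} → T p ≡ X (r ⊕ p) → T (⊖ r ⊕ (r ⊕ p)) ≡ X (r ⊕ p)
  unrotated {p} = trans (cong T (\\-leftDividesʳ r p))

  keeps : Keeps X (rotate (⊖ r) T)
  keeps = r ⊕ c , s , s∈S , unrotated keep₁ ,
          keeps-at {X} {rotate (⊖ r) T} (⊕-assoc r c (idx 7 s)) (unrotated keep₂)

Reaches-mirror : {X : Position 7} → Reaches (mirror X) → Reaches X
Reaches-mirror {X} (T , T≤ , (c , s , s∈S , keep₁ , keep₂) , pT) =
  mirror T , below , keeps , RotP₇-mirror {T} pT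
  where
  d : Fin 7
  d = idx 7 s

  below : Pointwise _≤_ (mirror T) X
  below p = subst (T (⊖ p) ≤_) (cong X (⁻¹-involutive p)) (T≤ (⊖ p))

  unmirrored : ∀ {p} → T p ≡ X (⊖ p) → T (⊖ ⊖ p) ≡ X (⊖ p)
  unmirrored {p} = trans (cong T (⁻¹-involutive p))

  reflected : ⊖ (c ⊕ d) ⊕ d ≡ ⊖ c
  reflected = trans (cong (_⊕ d) (sym (⁻¹-∙-comm c d))) (//-rightDividesˡ d (⊖ c))

  keeps : Keeps X (mirror T)
  keeps = ⊖ (c ⊕ d) , s , s∈S , unmirrored keep₂ , keeps-at {X} {mirror T} reflected (unmirrored keep₁)

shape-below : {X : Position 7} {b x y : ℕ} →
              b ≤ X 1F → b ≤ X 2F → x ≤ X 3F → y ≤ X 4F → b ≤ X 5F → b ≤ X 6F →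
              Pointwise _≤_ (shape b x y) X
shape-below b≤1 b≤2 x≤3 y≤4 b≤5 b≤6 = λ where
  0F → z≤n
  1F → b≤1
  2F → b≤2
  3F → x≤3
  4F → y≤4
  5F → b≤5
  6F → b≤6

⊓-glb₃ : ∀ {a x y z} → a ≤ x → a ≤ y → a ≤ z → a ≤ x ⊓ y ⊓ z
⊓-glb₃ a≤x a≤y a≤z = ⊓-glb (⊓-glb a≤x a≤y) a≤z

m⊓n⊓o≤m : ∀ m n o → m ⊓ n ⊓ o ≤ m
m⊓n⊓o≤m m n o = ≤-trans (m⊓n≤m (m ⊓ n) o) (m⊓n≤m m n)

m⊓n⊓o≤n : ∀ m n o → m ⊓ n ⊓ o ≤ n
m⊓n⊓o≤n m n o = ≤-trans (m⊓n≤m (m ⊓ n) o) (m⊓n≤n m n)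

reaches-keeping-3F : {X : Position 7} → X 3F ≤ X 1F ⊓ X 2F ⊓ X 5F → X 1F ⊓ X 2F ⊓ X 5F ≤ X 6F → Reaches X
reaches-keeping-3F {X} x≤b b≤6 = [ keeping-3F-4F , keeping-3F-top ]′ (≤-total s b)
  where
  b s : ℕ
  b = X 1F ⊓ X 2F ⊓ X 5F
  s = X 3F + X 4F

  b≤1 : b ≤ X 1F
  b≤1 = m⊓n⊓o≤m (X 1F) (X 2F) (X 5F)
  b≤2 : b ≤ X 2F
  b≤2 = m⊓n⊓o≤n (X 1F) (X 2F) (X 5F)
  b≤5 : b ≤ X 5F
  b≤5 = m⊓n≤n (X 1F ⊓ X 2F) (X 5F)

  keeping-3F-4F : s ≤ b → Reaches X
  keeping-3F-4F s≤b =
    shape s (X 3F) (X 4F) ,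
    shape-below (≤-trans s≤b b≤1) (≤-trans s≤b b≤2) ≤-refl ≤-refl (≤-trans s≤b b≤5) (≤-trans s≤b b≤6) ,
    (3F , 1 , here refl , refl , refl) ,
    0F , shape-P₇ s (X 3F) (X 4F) refl

  T : Position 7
  T = shape b (X 3F) (b ∸ X 3F)

  keeps-top : Keeps X T
  keeps-top with ⊓-sel (X 1F ⊓ X 2F) (X 5F) | ⊓-sel (X 1F) (X 2F)
  ... | inj₂ b≡5  | _         = 3F , 2 , there (here refl) , refl , b≡5
  ... | inj₁ b≡12 | inj₁ 12≡1 = 1F , 2 , there (here refl) , trans b≡12 12≡1 , refl
  ... | inj₁ b≡12 | inj₂ 12≡2 = 2F , 1 , here refl , trans b≡12 12≡2 , refl

  keeping-3F-top : b ≤ s → Reaches X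
  keeping-3F-top b≤s =
    T , shape-below b≤1 b≤2 ≤-refl (m≤n+o⇒m∸n≤o b (X 3F) b≤s) b≤5 b≤6 ,
    keeps-top , 0F , shape-P₇ b (X 3F) (b ∸ X 3F) (m+[n∸m]≡n x≤b)

reaches-keeping-4F : {X : Position 7} → X 4F ≤ X 6F ⊓ X 5F ⊓ X 2F → X 6F ⊓ X 5F ⊓ X 2F ≤ X 1F → Reaches X
reaches-keeping-4F {X} y≤b b≤1 = Reaches-mirror (reaches-keeping-3F {mirror X} y≤b b≤1)

module _ {X : Position 7} (min : ∀ q → X 0F ≤ X q) (3≤4 : X 3F ≤ X 4F) where
  private
    c : ℕ
    c = X 1F ⊓ X 2F ⊓ X 5F
    c≤1 : c ≤ X 1F
    c≤1 = m⊓n⊓o≤m (X 1F) (X 2F) (X 5F)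
    c≤2 : c ≤ X 2F
    c≤2 = m⊓n⊓o≤n (X 1F) (X 2F) (X 5F)
    c≤5 : c ≤ X 5F
    c≤5 = m⊓n≤n (X 1F ⊓ X 2F) (X 5F)

  reaches-normalised : Reaches X
  reaches-normalised with ≤-<-connex c (X 4F)
  ... | inj₁ c≤4 = Reaches-rotate 3F (reaches-keeping-4F (⊓-glb₃ (min 2F) (min 1F) (min 5F))
                     (≤-trans (≤-reflexive (cong (_⊓ X 5F) (⊓-comm (X 2F) (X 1F)))) c≤4))
  ... | inj₂ 4<c with ≤-<-connex c (X 6F)
  ...   | inj₁ c≤6 = reaches-keeping-3F (≤-trans 3≤4 (<⇒≤ 4<c)) c≤6
  ...   | inj₂ 6<c with ≤-<-connex (X 6F) (X 4F)
  ...     | inj₁ 6≤4 = Reaches-rotate 3F (reaches-keeping-3F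
                         (⊓-glb₃ 6≤4 (<⇒≤ (<-≤-trans 6<c c≤5)) (<⇒≤ (<-≤-trans 6<c c≤1)))
                         (≤-trans (m⊓n⊓o≤m _ _ _) (<⇒≤ (<-≤-trans 4<c c≤2))))
  ...     | inj₂ 4<6 = reaches-keeping-4F
                         (⊓-glb₃ (<⇒≤ 4<6) (<⇒≤ (<-≤-trans 4<c c≤5)) (<⇒≤ (<-≤-trans 4<c c≤2)))
                         (≤-trans (m⊓n⊓o≤m _ _ _) (<⇒≤ (<-≤-trans 6<c c≤1)))

reaches-min-at-0F : {X : Position 7} → (∀ q → X 0F ≤ X q) → Reaches X
reaches-min-at-0F {X} min with ≤-total (X 3F) (X 4F)
... | inj₁ 3≤4 = reaches-normalised min 3≤4
... | inj₂ 4≤3 = Reaches-mirror (reaches-normalised {mirror X} (min ∘ ⊖_) 4≤3)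

reaches-from-min : (X : Position 7) → (∃ λ p → ∀ q → X p ≤ X q) → Reaches X
reaches-from-min X (p , p-min) = Reaches-rotate p (reaches-min-at-0F {rotate p X} λ q →
  subst (_≤ X (p ⊕ q)) (cong X (sym (⊕-identityʳ p))) (p-min (p ⊕ q)))

reaches : ∀ X → Reaches X
reaches X = reaches-from-min X (argmin X)

Reaches⇒RotP₇-or-move : {X : Position 7} → Reaches X → RotP₇ X ⊎ ∃ λ T → Move 7 strides 5 X T × RotP₇ T
Reaches⇒RotP₇-or-move {X} (T , T≤X , keeps , pT) = decide (any? (λ p → T p <? X p))
  where
  decide : Dec (∃ λ p → T p < X p) → RotP₇ X ⊎ ∃ λ T → Move 7 strides 5 X T × RotP₇ T
  decide (yes T<X) = inj₂ (T , Keeps⇒Move {X} {T} T≤X T<X keeps , pT)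
  decide (no  T≮X) = inj₁ (RotP₇-cong {T} {X} (λ p → ≤-antisym (T≤X p) (≮⇒≥ (T≮X ∘ (p ,_)))) pT)

reflected⇒mirrored : (M : Position 7) (i : Fin 7) →
                     P₇ (λ q → M (idx 7 (toℕ i + (7 ∸ 1) * toℕ q))) → P₇ (mirror (rotate i M))
-- For a fixed i both sides unfold to the same seven piles of M.
reflected⇒mirrored M 0F p = p
reflected⇒mirrored M 1F p = p
reflected⇒mirrored M 2F p = p
reflected⇒mirrored M 3F p = p
reflected⇒mirrored M 4F p = p
reflected⇒mirrored M 5F p = p
reflected⇒mirrored M 6F p = p

RotP₇⇔∈↻ : (M : Position 7) → RotP₇ M ⇔ M ∈↻ P₇
RotP₇⇔∈↻ M = mk⇔ (λ (r , p) → r , inj₁ p) from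
  where
  from : M ∈↻ P₇ → RotP₇ M
  from (i , inj₁ p) = i , p
  from (i , inj₂ p) = i , P₇-mirror {mirror (rotate i M)} (reflected⇒mirrored M i p)

mainTheorem8 : (M : Position 7) → IsP 7 (1 ∷ 2 ∷ []) 5 M ⇔ (M ∈↻ P₇)
mainTheorem8 M = RotP₇⇔∈↻ M ⇔-∘ IsP⇔ RotP₇ RotP₇-stable (Reaches⇒RotP₇-or-move ∘ reaches) M
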